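{- Let $a,b,c$ be positive integers and let $p(z)=\sum_{i=0}^D a_iz^i\in\mathbb{Z}[z]$ with $a_D\in\mathbb{Z}^+$, $c\mid a_1$ and $c^2\mid a_0$. Assume that the equation $ax+by=c^{ -2}p(cz)=\sum_{i=0}^D a_ic^{i-2}z^i$ is 2-Ramsey. Then the equation $acx+bcy=p(z)$ is 2-Ramsey.
   Context: For $k\in\mathbb{Z}^+$, an equation in the variables $x,y,z$ is called $k$-Ramsey if every colouring of the positive integers $\mathbb{Z}^+$ with $k$ colours admits infinitely many monochromatic solutions $(x,y,z)\in(\mathbb{Z}^+)^3$, i.e. solutions with $x,y,z$ all receiving the same colour. -}

module Defs where

open import Data.Nat as ℕ using (ℕ; suc; _<_)
open import Data.Integer as ℤ using (ℤ; +_; _+_; _*_; _>_)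
open import Data.Fin using (Fin)
open import Data.Empty using (⊥)
open import Data.List using (List; []; _∷_)
open import Data.Product using (Σ; ∃; _×_; _,_)
open import Relation.Binary.PropositionalEquality using (_≡_)

Equation : Set₁
Equation = ℤ → ℤ → ℤ → Set

-- k-Ramsey: every colouring of ℤ⁺ with k colours admits infinitely many
-- monochromatic solutions (x,y,z) ∈ (ℤ⁺)³.  Colourings are functions on ℕ
-- whose value at 0 is irrelevant (only positive arguments are used).
-- "Infinitely many" is expressed as: for every bound N there is a
-- monochromatic solution with N < x + y + z (equivalent, since there are
-- only finitely many positive triples with x + y + z ≤ N).
Ramsey : ℕ → Equation → Set
Ramsey k E =
  (χ : ℕ → Fin k) → (N : ℕ) →
  Σ ℕ λ x → Σ ℕ λ y → Σ ℕ λ z →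
    (0 < x) × (0 < y) × (0 < z) × (N < x ℕ.+ y ℕ.+ z) ×
    (χ x ≡ χ y) × (χ y ≡ χ z) × E (+ x) (+ y) (+ z)

-- Polynomials with integer coefficients as coefficient lists, constant
-- term first: a₀ ∷ a₁ ∷ … ∷ a_D ∷ [].
Poly : Set
Poly = List ℤ

eval : Poly → ℤ → ℤ
eval []       z = + 0
eval (a ∷ as) z = a + z * eval as z

LeadingPositive : Poly → Set
LeadingPositive []           = ⊥
LeadingPositive (a ∷ [])     = a > + 0
LeadingPositive (a ∷ b ∷ as) = LeadingPositive (b ∷ as)

coeff0 : Poly → ℤ
coeff0 []      = + 0
coeff0 (a ∷ _) = a

coeff1 : Poly → ℤ
coeff1 []          = + 0
coeff1 (_ ∷ [])    = + 0
coeff1 (_ ∷ b ∷ _) = b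

{-# OPTIONS --safe #-}
module Submission where

open import Defs
open import Data.Nat using (ℕ; NonZero)
open import Data.Integer using (ℤ; +_; _+_; _*_)
open import Data.Integer.Divisibility using (_∣_)
open import Relation.Binary.PropositionalEquality using (_≡_)
import Data.Nat as ℕ
import Data.Nat.Properties as ℕ
open import Data.Integer.Properties using (pos-*)
open import Data.Integer.Solver using (module +-*-Solver)
open import Data.Product using (_,_)
open import Relation.Binary.PropositionalEquality using (refl; sym; cong; cong₂; module ≡-Reasoning)

-- Colour n by the colour of c n: a monochromatic solution of E for this
-- colouring scales to a monochromatic solution of F for the original one.
Ramsey-scale : ∀ {k} (c : ℕ) .{{_ : NonZero c}} {E F : Equation} →
  (∀ x y z → E (+ x) (+ y) (+ z) → F (+ (c ℕ.* x)) (+ (c ℕ.* y)) (+ (c ℕ.* z))) →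
  Ramsey k E → Ramsey k F
Ramsey-scale c E⇒F R χ N with R (λ n → χ (c ℕ.* n)) N
... | x , y , z , 0<x , 0<y , 0<z , N<x+y+z , χx≡χy , χy≡χz , Exyz =
  c ℕ.* x , c ℕ.* y , c ℕ.* z ,
  ℕ.<-≤-trans 0<x (ℕ.m≤n*m x c) ,
  ℕ.<-≤-trans 0<y (ℕ.m≤n*m y c) ,
  ℕ.<-≤-trans 0<z (ℕ.m≤n*m z c) ,
  ℕ.<-≤-trans N<x+y+z (ℕ.+-mono-≤ (ℕ.+-mono-≤ (ℕ.m≤n*m x c) (ℕ.m≤n*m y c)) (ℕ.m≤n*m z c)) ,
  χx≡χy , χy≡χz , E⇒F x y z Exyz

linear-scale : (a b c x y : ℤ) → a * c * (c * x) + b * c * (c * y) ≡ c * c * (a * x + b * y)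
linear-scale = solve 5 (λ a b c x y → a :* c :* (c :* x) :+ b :* c :* (c :* y) := c :* c :* (a :* x :+ b :* y)) refl
  where open +-*-Solver

lemma3p1 : (a b c : ℕ) → .{{_ : NonZero a}} → .{{_ : NonZero b}} → .{{_ : NonZero c}} →
    (p : Poly) → LeadingPositive p →
    (+ c) ∣ coeff1 p → (+ c * + c) ∣ coeff0 p →
    Ramsey 2 (λ x y z → (+ c * + c) * (+ a * x + + b * y) ≡ eval p (+ c * z)) →
    Ramsey 2 (λ x y z → + a * + c * x + + b * + c * y ≡ eval p z)
lemma3p1 a b c p _ _ _ = Ramsey-scale c {E = hypothesis} {F = conclusion} scaled-solution
  where
  open ≡-Reasoning
  hypothesis conclusion : Equation
  hypothesis x y z = (+ c * + c) * (+ a * x + + b * y) ≡ eval p (+ c * z)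
  conclusion x y z = + a * + c * x + + b * + c * y ≡ eval p z

  scaled-solution : ∀ x y z → hypothesis (+ x) (+ y) (+ z) →
    conclusion (+ (c ℕ.* x)) (+ (c ℕ.* y)) (+ (c ℕ.* z))
  scaled-solution x y z eq = begin
    + a * + c * + (c ℕ.* x) + + b * + c * + (c ℕ.* y)
      ≡⟨ cong₂ _+_ (cong (+ a * + c *_) (pos-* c x)) (cong (+ b * + c *_) (pos-* c y)) ⟩
    + a * + c * (+ c * + x) + + b * + c * (+ c * + y)
      ≡⟨ linear-scale (+ a) (+ b) (+ c) (+ x) (+ y) ⟩
    + c * + c * (+ a * + x + + b * + y)
      ≡⟨ eq ⟩
    eval p (+ c * + z)
      ≡⟨ cong (eval p) (sym (pos-* c z)) ⟩
    eval p (+ (c ℕ.* z)) ∎
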